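{- Let $n\ge 2$ and $a$ be integers such that $x^n-a$ is irreducible over $\mathbb{Q}$. Let $p$ be a prime dividing $n$ and let $s\ge 1$ be the exponent of the highest power of $p$ dividing $n$. Assume that $p\nmid a$ and that $r=v_p(a^{p-1}-1)-1$ is positive. Let $k$ be an integer with $1\le k\le\min\{r,s\}$, let $b'$ be an integer with $ab'\equiv1\pmod{p^{k+1}}$, and put $a'=(b')^{p^{s-k-1}}$ if $k<s$ and $a'=b'$ if $k=s$. Then for every integer $j$ with $1\le j\le p^k$, $p^{jk}$ divides $\binom{p^k}{j}\left(a(a')^{p^k}-1\right)^{j-1}$.
   Context: $v_p(x)$ denotes the exponent of the highest power of the prime $p$ dividing the nonzero integer $x$. -}

module Defs where

open import Data.Nat as ℕ using (ℕ; zero; suc; _<?_)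
open import Data.Integer as ℤ using (ℤ)
open import Data.Rational as ℚ using (ℚ; 0ℚ; 1ℚ)
open import Data.List using (List; []; _∷_; map; drop; replicate)
open import Data.List.Relation.Unary.All using (All)
open import Data.Sum using (_⊎_)
open import Relation.Binary.PropositionalEquality using (_≡_)
open import Relation.Nullary using (yes; no)

-- Polynomials over ℚ as coefficient lists, lowest degree first.
Poly : Set
Poly = List ℚ

infixl 6 _+ₚ_
infixl 7 _*ₚ_

_+ₚ_ : Poly → Poly → Poly
[] +ₚ q = q
(c ∷ p) +ₚ [] = c ∷ p
(c ∷ p) +ₚ (d ∷ q) = (c ℚ.+ d) ∷ (p +ₚ q)

_*ₚ_ : Poly → Poly → Poly
[] *ₚ q = []
(c ∷ p) *ₚ q = map (c ℚ.*_) q +ₚ (0ℚ ∷ (p *ₚ q))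

-ₚ_ : Poly → Poly
-ₚ p = map ℚ.-_ p

IsZeroₚ : Poly → Set
IsZeroₚ p = All (_≡ 0ℚ) p

-- Equality of polynomials (coefficient lists up to trailing zeros).
_≈ₚ_ : Poly → Poly → Set
p ≈ₚ q = IsZeroₚ (p +ₚ (-ₚ q))

Constantₚ : Poly → Set
Constantₚ p = IsZeroₚ (drop 1 p)

XnMinus : ℕ → ℤ → Poly
XnMinus n a = ((ℚ.- (a ℚ./ 1)) ∷ replicate (ℕ.pred n) 0ℚ) +ₚ (replicate n 0ℚ Data.List.++ (1ℚ ∷ []))

-- x^n - a (n ≥ 1, so nonconstant and nonzero) is irreducible over ℚ:
-- in every factorization f * g = x^n - a one factor is a (nonzero) constant, i.e. a unit.
IrreducibleXnMinus : ℕ → ℤ → Set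
IrreducibleXnMinus n a = ∀ (f g : Poly) → (f *ₚ g) ≈ₚ XnMinus n a → Constantₚ f ⊎ Constantₚ g

aPrime : (p s k : ℕ) → ℤ → ℤ
aPrime p s k b with k <? s
... | yes _ = b ℤ.^ (p ℕ.^ (s ℕ.∸ k ℕ.∸ 1))
... | no _ = b

{-# OPTIONS --safe #-}
-- Since a' is b' raised to a power of p, and p^m ≡ 1 modulo p - 1, the congruences
-- a^(p-1) ≡ 1 and a b' ≡ 1 modulo p^(k+1) give c := a (a')^(p^k) - 1 ≡ 0 modulo p^(k+1).
-- On the other hand j C(p^k, j) = p^k C(p^k - 1, j - 1) and v_p(j) ≤ j - 1, so
-- v_p(C(p^k, j)) ≥ k - (j - 1); together with v_p(c^(j-1)) ≥ (k + 1)(j - 1) this gives jk.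
module Submission where

open import Defs
open import Data.Nat using (ℕ; _≤_; _^_; _*_; _∸_; _+_)
open import Data.Nat.Primality using (Prime)
open import Data.Nat.Combinatorics using (_C_)
open import Data.Integer using (ℤ; +_; _-_) renaming (_*_ to _*ℤ_; _^_ to _^ℤ_; _+_ to _+ℤ_)
open import Data.Integer.Divisibility using () renaming (_∣_ to _∣ℤ_)
open import Relation.Nullary using (¬_)

open import Data.Nat.Base using (zero; suc; _<_; NonZero; s<s⁻¹; nonTrivial⇒n>1)
open import Data.Nat.Properties
  using (*-comm; *-assoc; *-zeroʳ; *-identityˡ; *-identityʳ; *-distribˡ-+; +-assoc; +-monoˡ-≤;
         m+[n∸m]≡n; m<m*n; _<?_; ^-distribˡ-+-*; ^-*-assoc)
open import Data.Nat.Divisibility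
  using (_∣_; divides; _∣?_; ∣-refl; ∣-trans; m∣m*n; ∣n⇒∣m*n; *-pres-∣; *-monoʳ-∣; *-monoˡ-∣;
         *-cancelˡ-∣; 1∣_; _∣0; module ∣-Reasoning)
open import Data.Nat.Primality using (euclidsLemma; prime⇒nonZero; prime⇒nonTrivial; ¬prime[0])
open import Data.Nat.Combinatorics using (nC1≡n; nCk+nC[k+1]≡[n+1]C[k+1])
open import Data.Nat.Induction using (<-wellFounded)
open import Induction.WellFounded using (Acc; acc)
open import Data.Integer.Base using (1ℤ; ∣_∣)
import Data.Integer.Properties as ℤ
import Data.Integer.Divisibility.Signed as Signed
import Data.Integer.Tactic.RingSolver as ℤ-Solver
open import Data.Nat.Tactic.RingSolver using (solve-∀)
open import Data.Product using (∃-syntax; _,_)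
open import Data.Sum using (inj₁; inj₂)
open import Relation.Binary.PropositionalEquality
open import Relation.Nullary using (yes; no; contradiction)

[k+1]*[n+1]C[k+1]≡[n+1]*nCk : ∀ n k → suc k * (suc n C suc k) ≡ suc n * (n C k)
[k+1]*[n+1]C[k+1]≡[n+1]*nCk zero zero = refl
[k+1]*[n+1]C[k+1]≡[n+1]*nCk zero (suc k) = *-zeroʳ (suc (suc k))
[k+1]*[n+1]C[k+1]≡[n+1]*nCk (suc n) zero =
  trans (*-identityˡ _) (trans (nC1≡n (suc (suc n))) (sym (*-identityʳ (suc (suc n)))))
[k+1]*[n+1]C[k+1]≡[n+1]*nCk (suc n) (suc k) = begin
  suc (suc k) * (suc (suc n) C suc (suc k))
    ≡⟨ cong (suc (suc k) *_) (nCk+nC[k+1]≡[n+1]C[k+1] (suc n) (suc k)) ⟨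
  suc (suc k) * (A + B)
    ≡⟨ *-distribˡ-+ (suc (suc k)) A B ⟩
  (A + suc k * A) + suc (suc k) * B
    ≡⟨ cong₂ (λ u v → (A + u) + v) ([k+1]*[n+1]C[k+1]≡[n+1]*nCk n k)
                                   ([k+1]*[n+1]C[k+1]≡[n+1]*nCk n (suc k)) ⟩
  (A + suc n * (n C k)) + suc n * (n C suc k)
    ≡⟨ +-assoc A _ _ ⟩
  A + (suc n * (n C k) + suc n * (n C suc k))
    ≡⟨ cong (λ u → A + u) (*-distribˡ-+ (suc n) (n C k) (n C suc k)) ⟨
  A + suc n * (n C k + n C suc k)
    ≡⟨ cong (λ u → A + suc n * u) (nCk+nC[k+1]≡[n+1]C[k+1] n k) ⟩
  A + suc n * A
    ∎
  where
  open ≡-Reasoning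
  A B : ℕ
  A = suc n C suc k
  B = suc n C suc (suc k)

n∣[k+1]*nC[k+1] : ∀ n k → n ∣ suc k * (n C suc k)
n∣[k+1]*nC[k+1] zero k rewrite *-zeroʳ k = ∣-refl
n∣[k+1]*nC[k+1] (suc n) k rewrite [k+1]*[n+1]C[k+1]≡[n+1]*nCk n k = m∣m*n (n C k)

^-monoʳ-∣ : ∀ p {m n} → m ≤ n → p ^ m ∣ p ^ n
^-monoʳ-∣ p {m} {n} m≤n = divides (p ^ (n ∸ m)) (begin
  p ^ n                ≡⟨ cong (p ^_) (m+[n∸m]≡n m≤n) ⟨
  p ^ (m + (n ∸ m))    ≡⟨ ^-distribˡ-+-* p m (n ∸ m) ⟩
  p ^ m * p ^ (n ∸ m)  ≡⟨ *-comm (p ^ m) _ ⟩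
  p ^ (n ∸ m) * p ^ m  ∎)
  where open ≡-Reasoning

^-monoˡ-∣ : ∀ {m n} k → m ∣ n → m ^ k ∣ n ^ k
^-monoˡ-∣ zero    m∣n = ∣-refl
^-monoˡ-∣ (suc k) m∣n = *-pres-∣ m∣n (^-monoˡ-∣ k m∣n)

p^k∣p^i*x⇒p^[k+1]∣d⇒p^[[1+i]k]∣x*dⁱ : ∀ p k i x d →
  p ^ k ∣ p ^ i * x → p ^ (k + 1) ∣ d → p ^ (suc i * k) ∣ x * d ^ i
p^k∣p^i*x⇒p^[k+1]∣d⇒p^[[1+i]k]∣x*dⁱ p k i x d p^k∣p^i*x p^[k+1]∣d = begin
  p ^ (k + i * k)           ≡⟨ ^-distribˡ-+-* p k (i * k) ⟩
  p ^ k * p ^ (i * k)       ∣⟨ *-monoˡ-∣ (p ^ (i * k)) p^k∣p^i*x ⟩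
  p ^ i * x * p ^ (i * k)   ≡⟨ exponents ⟩
  x * (p ^ (k + 1)) ^ i     ∣⟨ *-monoʳ-∣ x (^-monoˡ-∣ i p^[k+1]∣d) ⟩
  x * d ^ i                 ∎
  where
  open ∣-Reasoning
  i+i*k≡[k+1]*i : ∀ i k → i + i * k ≡ (k + 1) * i
  i+i*k≡[k+1]*i = solve-∀
  exponents : p ^ i * x * p ^ (i * k) ≡ x * (p ^ (k + 1)) ^ i
  exponents = begin-equality
    p ^ i * x * p ^ (i * k)    ≡⟨ cong (_* p ^ (i * k)) (*-comm (p ^ i) x) ⟩
    x * p ^ i * p ^ (i * k)    ≡⟨ *-assoc x _ _ ⟩
    x * (p ^ i * p ^ (i * k))  ≡⟨ cong (x *_) (^-distribˡ-+-* p i (i * k)) ⟨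
    x * p ^ (i + i * k)        ≡⟨ cong (λ e → x * p ^ e) (i+i*k≡[k+1]*i i k) ⟩
    x * p ^ ((k + 1) * i)      ≡⟨ cong (x *_) (^-*-assoc p (k + 1) i) ⟨
    x * (p ^ (k + 1)) ^ i      ∎

module _ {p : ℕ} (p-prime : Prime p) where

  private instance
    p≢0 : NonZero p
    p≢0 = prime⇒nonZero p-prime

  ¬p∣u⇒p^k∣u*x⇒p^k∣x : ∀ k {u x} → ¬ p ∣ u → p ^ k ∣ u * x → p ^ k ∣ x
  ¬p∣u⇒p^k∣u*x⇒p^k∣x zero    {x = x} _ _ = 1∣ x
  ¬p∣u⇒p^k∣u*x⇒p^k∣x (suc k) {u} {x} p∤u p^[1+k]∣u*x
    with euclidsLemma u x p-prime (∣-trans (m∣m*n (p ^ k)) p^[1+k]∣u*x)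
  ... | inj₁ p∣u = contradiction p∣u p∤u
  ... | inj₂ (divides y refl) =
    subst (p * p ^ k ∣_) (*-comm p y) (*-monoʳ-∣ p (¬p∣u⇒p^k∣u*x⇒p^k∣x k p∤u p^k∣u*y))
    where
    p^k∣u*y : p ^ k ∣ u * y
    p^k∣u*y = *-cancelˡ-∣ p (subst (p * p ^ k ∣_) (x*[y*z]≡z*[x*y] u y p) p^[1+k]∣u*x)
      where
      x*[y*z]≡z*[x*y] : ∀ x y z → x * (y * z) ≡ z * (x * y)
      x*[y*z]≡z*[x*y] = solve-∀

  -- v_p(1 + m) ≤ m: each factor p of 1 + m is traded for one factor p of p ^ m.
  p^k∣[1+m]*x⇒p^k∣p^m*x : ∀ k m x → p ^ k ∣ suc m * x → p ^ k ∣ p ^ m * x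
  p^k∣[1+m]*x⇒p^k∣p^m*x k m = go m (<-wellFounded m)
    where
    go : ∀ m → Acc _<_ m → ∀ x → p ^ k ∣ suc m * x → p ^ k ∣ p ^ m * x
    go m (acc rec) x h with p ∣? suc m
    ... | no p∤1+m = ∣n⇒∣m*n (p ^ m) (¬p∣u⇒p^k∣u*x⇒p^k∣x k p∤1+m h)
    ... | yes (divides (suc m′) 1+m≡[1+m′]*p) = begin
      p ^ k                 ∣⟨ go m′ (rec m′<m) (p * x) (subst (p ^ k ∣_) [1+m]*x≡[1+m′]*[p*x] h) ⟩
      p ^ m′ * (p * x)      ≡⟨ *-assoc (p ^ m′) p x ⟨
      p ^ m′ * p * x        ≡⟨ cong (_* x) (*-comm (p ^ m′) p) ⟩
      p ^ suc m′ * x        ∣⟨ *-monoˡ-∣ x (^-monoʳ-∣ p m′<m) ⟩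
      p ^ m * x             ∎
      where
      open ∣-Reasoning
      m′<m : m′ < m
      m′<m = s<s⁻¹ (subst (suc m′ <_) (sym 1+m≡[1+m′]*p)
                     (m<m*n (suc m′) p (nonTrivial⇒n>1 p {{prime⇒nonTrivial p-prime}})))
      [1+m]*x≡[1+m′]*[p*x] : suc m * x ≡ suc m′ * (p * x)
      [1+m]*x≡[1+m′]*[p*x] = trans (cong (_* x) 1+m≡[1+m′]*p) (*-assoc (suc m′) p x)

∣i^n∣≡∣i∣^n : ∀ i n → ∣ i ^ℤ n ∣ ≡ ∣ i ∣ ^ n
∣i^n∣≡∣i∣^n i zero    = refl
∣i^n∣≡∣i∣^n i (suc n) = trans (ℤ.abs-* i (i ^ℤ n)) (cong (∣ i ∣ *_) (∣i^n∣≡∣i∣^n i n))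

module _ {d : ℤ} where

  ∣a*x-1⇒∣aⁿ*xⁿ-1 : ∀ a x → d Signed.∣ a *ℤ x - 1ℤ → ∀ n → d Signed.∣ a ^ℤ n *ℤ x ^ℤ n - 1ℤ
  ∣a*x-1⇒∣aⁿ*xⁿ-1 a x d∣ax-1 zero    = Signed.∣ᵤ⇒∣ (∣ d ∣ ∣0)
  ∣a*x-1⇒∣aⁿ*xⁿ-1 a x d∣ax-1 (suc n) =
    subst (d Signed.∣_) (sym (split a x (a ^ℤ n) (x ^ℤ n)))
      (Signed.∣m∣n⇒∣m+n (Signed.∣m⇒∣m*n (a ^ℤ n *ℤ x ^ℤ n) d∣ax-1) (∣a*x-1⇒∣aⁿ*xⁿ-1 a x d∣ax-1 n))
    where
    split : ∀ a x A X → a *ℤ A *ℤ (x *ℤ X) - 1ℤ ≡ (a *ℤ x - 1ℤ) *ℤ (A *ℤ X) +ℤ (A *ℤ X - 1ℤ)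
    split = ℤ-Solver.solve-∀

  ∣a^q-1⇒∣a*x-1⇒∣a*x^[1+q]-1 : ∀ a x q → d Signed.∣ a ^ℤ q - 1ℤ → d Signed.∣ a *ℤ x - 1ℤ →
                                d Signed.∣ a *ℤ x ^ℤ suc q - 1ℤ
  ∣a^q-1⇒∣a*x-1⇒∣a*x^[1+q]-1 a x q d∣a^q-1 d∣ax-1 =
    subst (d Signed.∣_) (sym (split a x (a ^ℤ q) (x ^ℤ q)))
      (Signed.∣m∣n⇒∣m+n
        (Signed.∣m∣n⇒∣m-n (Signed.∣m⇒∣m*n (x ^ℤ q) d∣ax-1) (Signed.∣n⇒∣m*n (x ^ℤ q) d∣a^q-1))
        (∣a*x-1⇒∣aⁿ*xⁿ-1 a x d∣ax-1 q))
    where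
    split : ∀ a x A X → a *ℤ (x *ℤ X) - 1ℤ ≡ (a *ℤ x - 1ℤ) *ℤ X - X *ℤ (A - 1ℤ) +ℤ (A *ℤ X - 1ℤ)
    split = ℤ-Solver.solve-∀

  ∣a^q-1⇒∣a*x-1⇒∣a*x^[[1+q]^m]-1 : ∀ a x q → d Signed.∣ a ^ℤ q - 1ℤ → d Signed.∣ a *ℤ x - 1ℤ →
                                    ∀ m → d Signed.∣ a *ℤ x ^ℤ (suc q ^ m) - 1ℤ
  ∣a^q-1⇒∣a*x-1⇒∣a*x^[[1+q]^m]-1 a x q d∣a^q-1 d∣ax-1 zero =
    subst (λ y → d Signed.∣ a *ℤ y - 1ℤ) (sym (ℤ.^-identityʳ x)) d∣ax-1
  ∣a^q-1⇒∣a*x-1⇒∣a*x^[[1+q]^m]-1 a x q d∣a^q-1 d∣ax-1 (suc m) =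
    subst (λ y → d Signed.∣ a *ℤ y - 1ℤ) x^[p^m]^p≡x^p^[1+m]
      (∣a^q-1⇒∣a*x-1⇒∣a*x^[1+q]-1 a (x ^ℤ (suc q ^ m)) q d∣a^q-1
        (∣a^q-1⇒∣a*x-1⇒∣a*x^[[1+q]^m]-1 a x q d∣a^q-1 d∣ax-1 m))
    where
    x^[p^m]^p≡x^p^[1+m] : (x ^ℤ (suc q ^ m)) ^ℤ suc q ≡ x ^ℤ (suc q ^ suc m)
    x^[p^m]^p≡x^p^[1+m] =
      trans (ℤ.^-*-assoc x (suc q ^ m) (suc q)) (cong (x ^ℤ_) (*-comm (suc q ^ m) (suc q)))

aPrime^p^k≡b^p^m : ∀ p s k b → ∃[ m ] aPrime p s k b ^ℤ (p ^ k) ≡ b ^ℤ (p ^ m)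
aPrime^p^k≡b^p^m p s k b with k <? s
... | yes _ = s ∸ k ∸ 1 + k , trans (ℤ.^-*-assoc b (p ^ (s ∸ k ∸ 1)) (p ^ k))
                                   (cong (b ^ℤ_) (sym (^-distribˡ-+-* p (s ∸ k ∸ 1) k)))
... | no _  = k , refl

lemma2p1 : (n : ℕ) (a : ℤ) → 2 ≤ n → IrreducibleXnMinus n a →
    (p : ℕ) → Prime p → (s : ℕ) → (+ (p ^ s)) ∣ℤ (+ n) → ¬ ((+ (p ^ (s + 1))) ∣ℤ (+ n)) → 1 ≤ s →
    ¬ ((+ p) ∣ℤ a) →
    (r : ℕ) → (+ (p ^ (r + 1))) ∣ℤ ((a ^ℤ (p ∸ 1)) - + 1) → ¬ ((+ (p ^ (r + 2))) ∣ℤ ((a ^ℤ (p ∸ 1)) - + 1)) → 1 ≤ r →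
    (k : ℕ) → 1 ≤ k → k ≤ r → k ≤ s →
    (b′ : ℤ) → (+ (p ^ (k + 1))) ∣ℤ ((a *ℤ b′) - + 1) →
    (j : ℕ) → 1 ≤ j → j ≤ p ^ k →
    (+ (p ^ (j * k))) ∣ℤ ((+ ((p ^ k) C j)) *ℤ (((a *ℤ (aPrime p s k b′ ^ℤ (p ^ k))) - + 1) ^ℤ (j ∸ 1)))
lemma2p1 _ _ _ _ zero p-prime _ _ _ _ _ _ _ _ _ _ _ _ _ _ _ _ _ _ = contradiction p-prime ¬prime[0]
lemma2p1 _ a _ _ p@(suc q) p-prime s _ _ _ _ r p^[r+1]∣a^q-1 _ _ k _ k≤r _ b′ p^[k+1]∣ab′-1 (suc i) _ _ =
  subst (p ^ (suc i * k) ∣_) (sym ∣binom*cⁱ∣≡binom*∣c∣ⁱ)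
    (p^k∣p^i*x⇒p^[k+1]∣d⇒p^[[1+i]k]∣x*dⁱ p k i binom ∣ c ∣ p^k∣p^i*binom p^[k+1]∣c)
  where
  binom : ℕ
  binom = (p ^ k) C suc i
  c : ℤ
  c = a *ℤ aPrime p s k b′ ^ℤ (p ^ k) - + 1

  p^k∣p^i*binom : p ^ k ∣ p ^ i * binom
  p^k∣p^i*binom = p^k∣[1+m]*x⇒p^k∣p^m*x p-prime k i binom (n∣[k+1]*nC[k+1] (p ^ k) i)

  p^[k+1]∣a^q-1 : + p ^ (k + 1) Signed.∣ a ^ℤ q - 1ℤ
  p^[k+1]∣a^q-1 = Signed.∣ᵤ⇒∣ (∣-trans (^-monoʳ-∣ p (+-monoˡ-≤ 1 k≤r)) p^[r+1]∣a^q-1)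

  p^[k+1]∣c : p ^ (k + 1) ∣ ∣ c ∣
  p^[k+1]∣c with aPrime^p^k≡b^p^m p s k b′
  ... | m , a′^p^k≡b′^p^m = Signed.∣⇒∣ᵤ
    (subst (λ y → + p ^ (k + 1) Signed.∣ a *ℤ y - 1ℤ) (sym a′^p^k≡b′^p^m)
      (∣a^q-1⇒∣a*x-1⇒∣a*x^[[1+q]^m]-1 a b′ q p^[k+1]∣a^q-1 (Signed.∣ᵤ⇒∣ p^[k+1]∣ab′-1) m))

  ∣binom*cⁱ∣≡binom*∣c∣ⁱ : ∣ + binom *ℤ c ^ℤ i ∣ ≡ binom * ∣ c ∣ ^ i
  ∣binom*cⁱ∣≡binom*∣c∣ⁱ = trans (ℤ.abs-* (+ binom) (c ^ℤ i)) (cong (binom *_) (∣i^n∣≡∣i∣^n c i))
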